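{- Let $E$ be a finite totally ordered set with $r=|E|$ elements $e_1<e_2<\dots<e_r$. There are exactly two chirotopes of rank $r$ over $E$: one having $[e_1,\dots,e_r]$ as a positively oriented base, and the other having $[e_1,\dots,e_{r-1},\overline{e_r}]$ as a positively oriented base.
   Context: $\mathbf E=E\sqcup\overline E$ with involution $e\leftrightarrow\overline e$, $e^*=\overline e^*=e$. An oriented $d$-simplex is a tuple $[x_1,\dots,x_{d+1}]$ in $\mathbf E$ with $x_i^*$ pairwise distinct; $\Delta_d(E)$ is their set; $\sim$ is generated by $[\dots,x_i,x_{i+1},\dots]\sim[\dots,\overline{x_{i+1}},x_i,\dots]$; $-[x_1,\dots,x_{d+1}]=[x_1,\dots,x_d,\overline{x_{d+1}}]$. A chirotope of rank $r$ over $E$ is a map $\chi:\Delta_{r-1}(E)\to\{ -1,0,+1\}$ (with $\chi$ of a non-simplex tuple taken as $0$) satisfying (C1) each $e_1\in E$ has $e_2,\dots,e_r\in E$ with $\chi([e_1,\dots,e_r])\ne0$; (C2) $\chi(-\sigma)=-\chi(\sigma)$ and $\sigma\sim\tau\Rightarrow\chi(\sigma)=\chi(\tau)$; (C3) if $\chi([x_1,\dots,x_r])\ne0\ne\chi([y_1,\dots,y_r])$ then some $\chi([x_1,\dots,x_{r-1},y_i])\ne0$; (C4) if $\chi([x_1,\dots,x_{r-2},y_1,x_r])\chi([x_1,\dots,x_{r-1},y_2])\ge0$ and $\chi([x_1,\dots,x_{r-2},y_2,x_r])\chi([x_1,\dots,x_{r-1},\overline{y_1}])\ge0$ then $\chi([x_1,\dots,x_r])\chi([x_1,\dots,x_{r-2},y_1,y_2])\ge0$.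 A positively oriented base of $\chi$ is $\sigma$ with $\chi(\sigma)=+1$. -}

module Defs where

open import Data.Nat using (ℕ; zero; suc)
open import Data.Fin using (Fin)
open import Data.Bool using (Bool; true; false; not)
open import Data.Product using (_×_; _,_; proj₁; proj₂; Σ; ∃; ∃-syntax)
open import Data.Unit using (⊤)
open import Relation.Nullary using (¬_)
open import Data.Vec using (Vec; []; _∷_; lookup; map; init; _∷ʳ_; allFin)
open import Relation.Binary.PropositionalEquality using (_≡_; _≢_)
open import Relation.Binary.Construct.Closure.Equivalence using (EqClosure)

data Sign : Set where
  neg zer pos : Sign

-ˢ_ : Sign → Sign
-ˢ neg = pos
-ˢ zer = zer
-ˢ pos = neg

_*ˢ_ : Sign → Sign → Sign
zer *ˢ _ = zer
_ *ˢ zer = zer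
pos *ˢ s = s
neg *ˢ s = -ˢ s

NonNeg : Sign → Set
NonNeg s = s ≢ neg

-- The ground set E = {e_1 < ... < e_r} is identified with Fin r (ordered by index).
-- Signed elements of 𝐄 = E ⊔ Ē : (e , false) is e, (e , true) is ē.
SE : ℕ → Set
SE r = Fin r × Bool

bar : ∀ {r} → SE r → SE r
bar (e , b) = e , not b

star : ∀ {r} → SE r → Fin r
star = proj₁

ι : ∀ {r} → Fin r → SE r
ι e = e , false

IsSimplex : ∀ {r k} → Vec (SE r) k → Set
IsSimplex {k = k} σ = (i j : Fin k) → i ≢ j → star (lookup σ i) ≢ star (lookup σ j)

negT : ∀ {r k} → Vec (SE r) (suc k) → Vec (SE r) (suc k)
negT (x ∷ []) = bar x ∷ []
negT (x ∷ y ∷ xs) = x ∷ negT (y ∷ xs)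

swapAt : ∀ {r k} → Fin k → Vec (SE r) (suc k) → Vec (SE r) (suc k)
swapAt Fin.zero (x ∷ y ∷ xs) = bar y ∷ x ∷ xs
swapAt (Fin.suc i) (x ∷ xs) = x ∷ swapAt i xs

data Step {r k : ℕ} : Vec (SE r) (suc k) → Vec (SE r) (suc k) → Set where
  step : (i : Fin k) (σ : Vec (SE r) (suc k)) → Step σ (swapAt i σ)

_~_ : ∀ {r k} → Vec (SE r) (suc k) → Vec (SE r) (suc k) → Set
_~_ = EqClosure Step

snoc2 : ∀ {r m} → Vec (SE r) m → SE r → SE r → Vec (SE r) (suc (suc m))
snoc2 [] a b = a ∷ b ∷ []
snoc2 (x ∷ xs) a b = x ∷ snoc2 xs a b

-- axiom (C4); vacuous in rank 1 (where it does not make sense)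
C4 : ∀ {r} (n : ℕ) → (Vec (SE r) (suc n) → Sign) → Set
C4 zero χ = ⊤
C4 {r} (suc m) χ =
  (xs : Vec (SE r) m) (a b y₁ y₂ : SE r) →
  NonNeg (χ (snoc2 xs y₁ b) *ˢ χ (snoc2 xs a y₂)) →
  NonNeg (χ (snoc2 xs y₂ b) *ˢ χ (snoc2 xs a (bar y₁))) →
  NonNeg (χ (snoc2 xs a b) *ˢ χ (snoc2 xs y₁ y₂))

-- A chirotope of rank r = suc n over E = Fin (suc n).
-- χ is a map on all r-tuples which is 0 on non-simplices (the convention in the paper).
record Chirotope (n : ℕ) : Set where
  field
    χ : Vec (SE (suc n)) (suc n) → Sign
    nonSimplex : ∀ σ → ¬ IsSimplex σ → χ σ ≡ zer
    C1 : (e₁ : Fin (suc n)) → ∃[ es ] χ (map ι (e₁ ∷ es)) ≢ zer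
    C2-neg : ∀ σ → IsSimplex σ → χ (negT σ) ≡ -ˢ (χ σ)
    C2-sim : ∀ σ τ → IsSimplex σ → IsSimplex τ → σ ~ τ → χ σ ≡ χ τ
    C3 : ∀ x y → χ x ≢ zer → χ y ≢ zer →
         ∃[ i ] χ (init x ∷ʳ lookup y i) ≢ zer
    C4-ax : C4 n χ

{-# OPTIONS --safe #-}
-- A simplex of full rank r = |E| lists every element of E exactly once, each possibly
-- barred; call its parity the number of barred entries plus the number of inversions of
-- the underlying sequence, mod 2. Swapping two adjacent entries (barring one of them)
-- keeps the parity, negating the last entry flips it, and these moves connect every
-- full-rank simplex to the base [e₁,…,e_r]. By (C2) a chirotope changes along the moves
-- exactly as (−1)^parity, so it is ±(−1)^parity, fixed by its value at the base, which
-- (C1) forces to be nonzero. Conversely ±(−1)^parity is a chirotope: in (C3) and (C4)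
-- the simplices compared agree in all but their last one or two entries, so by fullness
-- they use the same elements there, and the axioms reduce to bookkeeping of the bars.
module Submission where

open import Defs
open import Data.Nat using (ℕ; zero; suc; _<ᵇ_)
open import Data.Nat.Properties using (n<1+n)
open import Data.Fin using (Fin; zero; suc; fromℕ; inject₁; toℕ; punchIn; punchOut; _≟_)
open import Data.Fin.Properties
  using (any?; all?; <⇒notInjective; punchOut-injective; punchIn-injective; punchInᵢ≢i; fromℕ≢inject₁
        ; suc-injective; toℕ-injective)
open import Data.Bool using (Bool; true; false; not; _xor_)
open import Data.Bool.Properties
  using (not-involutive; not-distribˡ-xor; not-distribʳ-xor; xor-assoc; xor-annihilates-not; xor-∧-commutativeRing)
open import Data.Product using (_×_; _,_; proj₂; Σ; ∃-syntax)
open import Data.Sum using (_⊎_; inj₁; inj₂)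
open import Data.Unit using (tt)
open import Data.Empty using (⊥-elim)
open import Data.Vec using (Vec; []; _∷_; map; allFin; init; last; _∷ʳ_; lookup; tabulate; removeAt)
open import Data.Vec.Properties using (lookup-map; map-∘; map-id; removeAt-punchOut; allFin-map; lookup∘tabulate)
open import Function using (_∘_; id; case_of_)
open import Function.Definitions using (Injective)
open import Algebra.Bundles using (CommutativeRing)
open import Relation.Nullary using (Dec; yes; no; ¬_; contradiction)
open import Relation.Nullary.Decidable using (¬?; _→-dec_)
open import Relation.Binary.PropositionalEquality
  using (_≡_; _≢_; refl; sym; trans; cong; cong₂; subst; module ≡-Reasoning)
open import Relation.Binary.Construct.Closure.ReflexiveTransitive using (Star; ε; _◅_; _◅◅_; gmap; return)
open import Relation.Binary.Construct.Closure.Symmetric using (fwd; bwd)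
open import Algebra.Properties.CommutativeSemigroup
  (CommutativeRing.+-commutativeSemigroup xor-∧-commutativeRing) using (x∙yz≈y∙xz; interchange)

open ≡-Reasoning

private
  variable
    r : ℕ

sg : Bool → Sign
sg false = pos
sg true = neg

sg≢zer : ∀ a → sg a ≢ zer
sg≢zer false ()
sg≢zer true ()

sg-xor : ∀ a b → sg (a xor b) ≡ sg a *ˢ sg b
sg-xor false false = refl
sg-xor false true = refl
sg-xor true false = refl
sg-xor true true = refl

sg-not : ∀ a → sg (not a) ≡ -ˢ sg a
sg-not false = refl
sg-not true = refl

sg-*ˢ-involutive : ∀ a s → sg a *ˢ (sg a *ˢ s) ≡ s
sg-*ˢ-involutive false neg = refl
sg-*ˢ-involutive false zer = refl
sg-*ˢ-involutive false pos = refl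
sg-*ˢ-involutive true neg = refl
sg-*ˢ-involutive true zer = refl
sg-*ˢ-involutive true pos = refl

sg-not-*ˢ-negated : ∀ a s → sg (not a) *ˢ (-ˢ s) ≡ sg a *ˢ s
sg-not-*ˢ-negated false neg = refl
sg-not-*ˢ-negated false zer = refl
sg-not-*ˢ-negated false pos = refl
sg-not-*ˢ-negated true neg = refl
sg-not-*ˢ-negated true zer = refl
sg-not-*ˢ-negated true pos = refl

*ˢ-identityˡ : ∀ s → pos *ˢ s ≡ s
*ˢ-identityˡ neg = refl
*ˢ-identityˡ zer = refl
*ˢ-identityˡ pos = refl

*ˢ-zeroʳ : ∀ s → s *ˢ zer ≡ zer
*ˢ-zeroʳ neg = refl
*ˢ-zeroʳ zer = refl
*ˢ-zeroʳ pos = refl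

nonzero⇒sg : ∀ {s} → s ≢ zer → ∃[ c ] s ≡ sg c
nonzero⇒sg {neg} _ = true , refl
nonzero⇒sg {zer} s≢0 = contradiction refl s≢0
nonzero⇒sg {pos} _ = false , refl

NonNeg-*ˢ-zero : ∀ {s t} → s ≡ zer ⊎ t ≡ zer → NonNeg (s *ˢ t)
NonNeg-*ˢ-zero (inj₁ refl) ()
NonNeg-*ˢ-zero {s} (inj₂ refl) = subst NonNeg (sym (*ˢ-zeroʳ s)) λ ()

NonNeg-sg-*ˢ⇒≡ : ∀ {a b} → NonNeg (sg a *ˢ sg b) → a ≡ b
NonNeg-sg-*ˢ⇒≡ {false} {false} _ = refl
NonNeg-sg-*ˢ⇒≡ {false} {true} h = contradiction refl h
NonNeg-sg-*ˢ⇒≡ {true} {false} h = contradiction refl h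
NonNeg-sg-*ˢ⇒≡ {true} {true} _ = refl

≡⇒NonNeg-sg-*ˢ : ∀ {a b} → a ≡ b → NonNeg (sg a *ˢ sg b)
≡⇒NonNeg-sg-*ˢ {false} refl ()
≡⇒NonNeg-sg-*ˢ {true} refl ()

xor-exchange : ∀ a c {u v} → a xor u ≡ c xor v → c xor u ≡ a xor v
xor-exchange false false e = e
xor-exchange true true e = e
xor-exchange false true e = trans (cong not e) (not-involutive _)
xor-exchange true false e = trans (sym (not-involutive _)) (cong not e)

injective⇒covering : ∀ {n} {f : Fin n → Fin n} → Injective _≡_ _≡_ f → ∀ y → ∃[ i ] f i ≡ y
injective⇒covering {suc n} {f} f-injective y with any? (λ i → f i ≟ y)
... | yes hit = hit
... | no miss = ⊥-elim (<⇒notInjective (n<1+n n) punchOut-injective′)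
  where
  avoids : ∀ i → y ≢ f i
  avoids i y≡fi = miss (i , sym y≡fi)

  punchOut-injective′ : Injective _≡_ _≡_ (λ i → punchOut (avoids i))
  punchOut-injective′ e = f-injective (punchOut-injective (avoids _) (avoids _) e)

simplex? : ∀ {k} (σ : Vec (SE r) k) → Dec (IsSimplex σ)
simplex? σ = all? λ i → all? λ j → ¬? (i ≟ j) →-dec ¬? (star (lookup σ i) ≟ star (lookup σ j))

simplex-injective : ∀ {k} (σ : Vec (SE r) k) → IsSimplex σ → Injective _≡_ _≡_ (λ i → star (lookup σ i))
simplex-injective σ s {i} {j} e with i ≟ j
... | yes i≡j = i≡j
... | no i≢j = contradiction e (s i j i≢j)

simplex-reindex : ∀ {k} (σ τ : Vec (SE r) k) (π : Fin k → Fin k) → Injective _≡_ _≡_ π →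
                  (∀ i → star (lookup τ i) ≡ star (lookup σ (π i))) → IsSimplex σ → IsSimplex τ
simplex-reindex σ τ π π-injective τ≈σ∘π s i j i≢j e =
  s (π i) (π j) (i≢j ∘ π-injective) (trans (sym (τ≈σ∘π i)) (trans e (τ≈σ∘π j)))

simplex-resp-stars : ∀ {k} (σ τ : Vec (SE r) k) → map star σ ≡ map star τ → IsSimplex σ → IsSimplex τ
simplex-resp-stars σ τ e = simplex-reindex σ τ id id λ i → begin
  star (lookup τ i)        ≡⟨ lookup-map i star τ ⟨
  lookup (map star τ) i    ≡⟨ cong (λ v → lookup v i) e ⟨
  lookup (map star σ) i    ≡⟨ lookup-map i star σ ⟩
  star (lookup σ i)        ∎

simplex-tail : ∀ {k x} {σ : Vec (SE r) k} → IsSimplex (x ∷ σ) → IsSimplex σ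
simplex-tail s i j i≢j = s (suc i) (suc j) (i≢j ∘ suc-injective)

map-ι-simplex : ∀ {k} (v : Vec (Fin r) k) → Injective _≡_ _≡_ (lookup v) → IsSimplex (map ι v)
map-ι-simplex v v-injective i j i≢j e =
  i≢j (v-injective (trans (cong star (sym (lookup-map i ι v))) (trans e (cong star (lookup-map j ι v)))))

Covers : ∀ {k} (σ : Vec (SE r) k) (τ : Vec (SE r) k) → Set
Covers σ τ = ∀ j → ∃[ i ] star (lookup σ i) ≡ star (lookup τ j)

swapIndex : ∀ {k} → Fin k → Fin (suc k) → Fin (suc k)
swapIndex zero zero = suc zero
swapIndex zero (suc zero) = zero
swapIndex zero (suc (suc j)) = suc (suc j)
swapIndex (suc i) zero = zero
swapIndex (suc i) (suc j) = suc (swapIndex i j)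

swapIndex-involutive : ∀ {k} (i : Fin k) j → swapIndex i (swapIndex i j) ≡ j
swapIndex-involutive zero zero = refl
swapIndex-involutive zero (suc zero) = refl
swapIndex-involutive zero (suc (suc j)) = refl
swapIndex-involutive (suc i) zero = refl
swapIndex-involutive (suc i) (suc j) = cong suc (swapIndex-involutive i j)

swapIndex-injective : ∀ {k} (i : Fin k) → Injective _≡_ _≡_ (swapIndex i)
swapIndex-injective i {j} {l} e =
  trans (sym (swapIndex-involutive i j)) (trans (cong (swapIndex i) e) (swapIndex-involutive i l))

star-lookup-swapAt : ∀ {k} (i : Fin k) (σ : Vec (SE r) (suc k)) j →
                     star (lookup (swapAt i σ) j) ≡ star (lookup σ (swapIndex i j))
star-lookup-swapAt zero (x ∷ y ∷ σ) zero = refl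
star-lookup-swapAt zero (x ∷ y ∷ σ) (suc zero) = refl
star-lookup-swapAt zero (x ∷ y ∷ σ) (suc (suc j)) = refl
star-lookup-swapAt (suc i) (x ∷ σ) zero = refl
star-lookup-swapAt (suc i) (x ∷ σ) (suc j) = star-lookup-swapAt i σ j

swapAt-simplex : ∀ {k} (i : Fin k) (σ : Vec (SE r) (suc k)) → IsSimplex σ → IsSimplex (swapAt i σ)
swapAt-simplex i σ = simplex-reindex σ (swapAt i σ) (swapIndex i) (swapIndex-injective i) (star-lookup-swapAt i σ)

swapAt-simplex⁻ : ∀ {k} (i : Fin k) (σ : Vec (SE r) (suc k)) → IsSimplex (swapAt i σ) → IsSimplex σ
swapAt-simplex⁻ i σ = simplex-reindex (swapAt i σ) σ (swapIndex i) (swapIndex-injective i) λ j → begin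
  star (lookup σ j)                                       ≡⟨ cong (star ∘ lookup σ) (swapIndex-involutive i j) ⟨
  star (lookup σ (swapIndex i (swapIndex i j)))           ≡⟨ star-lookup-swapAt i σ (swapIndex i j) ⟨
  star (lookup (swapAt i σ) (swapIndex i j))              ∎

stars-negT : ∀ {k} (σ : Vec (SE r) (suc k)) → map star (negT σ) ≡ map star σ
stars-negT (x ∷ []) = refl
stars-negT (x ∷ y ∷ σ) = cong (star x ∷_) (stars-negT (y ∷ σ))

negT-simplex : ∀ {k} (σ : Vec (SE r) (suc k)) → IsSimplex σ → IsSimplex (negT σ)
negT-simplex σ = simplex-resp-stars σ (negT σ) (sym (stars-negT σ))

simplex-covers : ∀ {n} (σ τ : Vec (SE n) n) → IsSimplex σ → Covers σ τ
simplex-covers σ τ s j = injective⇒covering (simplex-injective σ s) (star (lookup τ j))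

-- Parity

barParity : ∀ {k} → Vec (SE r) k → Bool
barParity [] = false
barParity (x ∷ σ) = proj₂ x xor barParity σ

<ᵇ-flip : ∀ m n → m ≢ n → (n <ᵇ m) ≡ not (m <ᵇ n)
<ᵇ-flip zero zero m≢n = contradiction refl m≢n
<ᵇ-flip zero (suc n) _ = refl
<ᵇ-flip (suc m) zero _ = refl
<ᵇ-flip (suc m) (suc n) m≢n = <ᵇ-flip m n (m≢n ∘ cong suc)

_≺_ : Fin r → Fin r → Bool
a ≺ b = toℕ a <ᵇ toℕ b

≺-flip : ∀ {a b : Fin r} → a ≢ b → (b ≺ a) ≡ not (a ≺ b)
≺-flip {a = a} {b} a≢b = <ᵇ-flip (toℕ a) (toℕ b) (a≢b ∘ toℕ-injective)

belowParity : ∀ {k} → Fin r → Vec (Fin r) k → Bool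
belowParity a [] = false
belowParity a (b ∷ v) = (b ≺ a) xor belowParity a v

inversionParity : ∀ {k} → Vec (Fin r) k → Bool
inversionParity [] = false
inversionParity (a ∷ v) = belowParity a v xor inversionParity v

parity : ∀ {k} → Vec (SE r) k → Bool
parity σ = barParity σ xor inversionParity (map star σ)

barParity-swapAt : ∀ {k} (i : Fin k) (σ : Vec (SE r) (suc k)) → barParity (swapAt i σ) ≡ not (barParity σ)
barParity-swapAt zero (x ∷ y ∷ σ) = begin
  not (proj₂ y) xor (proj₂ x xor barParity σ)   ≡⟨ not-distribˡ-xor (proj₂ y) _ ⟨
  not (proj₂ y xor (proj₂ x xor barParity σ))   ≡⟨ cong not (x∙yz≈y∙xz (proj₂ y) (proj₂ x) _) ⟩
  not (proj₂ x xor (proj₂ y xor barParity σ))   ∎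
barParity-swapAt (suc i) (x ∷ σ) =
  trans (cong (proj₂ x xor_) (barParity-swapAt i σ)) (sym (not-distribʳ-xor (proj₂ x) _))

belowParity-swapAt : ∀ {k} a (i : Fin k) (σ : Vec (SE r) (suc k)) →
                     belowParity a (map star (swapAt i σ)) ≡ belowParity a (map star σ)
belowParity-swapAt a zero (x ∷ y ∷ σ) = x∙yz≈y∙xz (star y ≺ a) (star x ≺ a) (belowParity a (map star σ))
belowParity-swapAt a (suc i) (x ∷ σ) = cong ((star x ≺ a) xor_) (belowParity-swapAt a i σ)

inversionParity-swapAt : ∀ {k} (i : Fin k) (σ : Vec (SE r) (suc k)) → IsSimplex σ →
                         inversionParity (map star (swapAt i σ)) ≡ not (inversionParity (map star σ))
inversionParity-swapAt zero (x ∷ y ∷ σ) s = begin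
  ((star x ≺ star y) xor b) xor (a xor I)         ≡⟨ cong (λ t → (t xor b) xor (a xor I)) (≺-flip y≢x) ⟩
  (not (star y ≺ star x) xor b) xor (a xor I)     ≡⟨ cong (_xor (a xor I)) (not-distribˡ-xor (star y ≺ star x) b) ⟨
  not ((star y ≺ star x) xor b) xor (a xor I)     ≡⟨ not-distribˡ-xor ((star y ≺ star x) xor b) (a xor I) ⟨
  not (((star y ≺ star x) xor b) xor (a xor I))   ≡⟨ cong not (interchange (star y ≺ star x) b a I) ⟩
  not (((star y ≺ star x) xor a) xor (b xor I))   ∎
  where
  a = belowParity (star x) (map star σ)
  b = belowParity (star y) (map star σ)
  I = inversionParity (map star σ)
  y≢x : star y ≢ star x
  y≢x = s (suc zero) zero (λ ())
inversionParity-swapAt (suc i) (x ∷ σ) s =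
  trans (cong₂ _xor_ (belowParity-swapAt (star x) i σ) (inversionParity-swapAt i σ (simplex-tail s)))
        (sym (not-distribʳ-xor (belowParity (star x) (map star σ)) (inversionParity (map star σ))))

parity-swapAt : ∀ {k} (i : Fin k) (σ : Vec (SE r) (suc k)) → IsSimplex σ → parity (swapAt i σ) ≡ parity σ
parity-swapAt i σ s =
  trans (cong₂ _xor_ (barParity-swapAt i σ) (inversionParity-swapAt i σ s))
        (xor-annihilates-not (barParity σ) (inversionParity (map star σ)))

barParity-negT : ∀ {k} (σ : Vec (SE r) (suc k)) → barParity (negT σ) ≡ not (barParity σ)
barParity-negT (x ∷ []) = sym (not-distribˡ-xor (proj₂ x) false)
barParity-negT (x ∷ y ∷ σ) =
  trans (cong (proj₂ x xor_) (barParity-negT (y ∷ σ))) (sym (not-distribʳ-xor (proj₂ x) _))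

parity-negT : ∀ {k} (σ : Vec (SE r) (suc k)) → parity (negT σ) ≡ not (parity σ)
parity-negT σ = trans (cong₂ _xor_ (barParity-negT σ) (cong inversionParity (stars-negT σ)))
                      (sym (not-distribˡ-xor (barParity σ) _))

parity-~ : ∀ {k} {σ τ : Vec (SE r) (suc k)} → IsSimplex σ → σ ~ τ → parity σ ≡ parity τ
parity-~ s ε = refl
parity-~ s (fwd (step i σ) ◅ steps) =
  trans (sym (parity-swapAt i σ s)) (parity-~ (swapAt-simplex i σ s) steps)
parity-~ s (bwd (step i μ) ◅ steps) =
  trans (parity-swapAt i μ (swapAt-simplex⁻ i μ s)) (parity-~ (swapAt-simplex⁻ i μ s) steps)

belowParity-zero : ∀ {r k} (v : Vec (Fin (suc r)) k) → belowParity zero v ≡ false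
belowParity-zero [] = refl
belowParity-zero (b ∷ v) = belowParity-zero v

inversionParity-map-suc : ∀ {r k} (v : Vec (Fin r) k) → inversionParity (map suc v) ≡ inversionParity v
inversionParity-map-suc [] = refl
inversionParity-map-suc (a ∷ v) = cong₂ _xor_ (belowParity-map-suc v) (inversionParity-map-suc v)
  where
  belowParity-map-suc : ∀ {k} (w : Vec (Fin _) k) → belowParity (suc a) (map suc w) ≡ belowParity a w
  belowParity-map-suc [] = refl
  belowParity-map-suc (b ∷ w) = cong ((b ≺ a) xor_) (belowParity-map-suc w)

inversionParity-allFin : ∀ n → inversionParity (allFin n) ≡ false
inversionParity-allFin zero = refl
inversionParity-allFin (suc n) = begin
  inversionParity (allFin (suc n))              ≡⟨ cong inversionParity (allFin-map n) ⟩
  inversionParity (zero ∷ map suc (allFin n))   ≡⟨ cong₂ _xor_ (belowParity-zero (map suc (allFin n)))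
                                                               (inversionParity-map-suc (allFin n)) ⟩
  inversionParity (allFin n)                    ≡⟨ inversionParity-allFin n ⟩
  false                                         ∎

base : ∀ n → Vec (SE (suc n)) (suc n)
base n = map ι (allFin (suc n))

base-simplex : ∀ n → IsSimplex (base n)
base-simplex n = map-ι-simplex (allFin (suc n)) λ {i} {j} e →
  trans (sym (lookup∘tabulate id i)) (trans e (lookup∘tabulate id j))

parity-base : ∀ n → parity (base n) ≡ false
parity-base n = cong₂ _xor_ (barParity-map-ι (allFin (suc n)))
  (trans (cong inversionParity (trans (sym (map-∘ star ι (allFin (suc n)))) (map-id (allFin (suc n)))))
         (inversionParity-allFin (suc n)))
  where
  barParity-map-ι : ∀ {r k} (v : Vec (Fin r) k) → barParity (map ι v) ≡ false
  barParity-map-ι [] = refl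
  barParity-map-ι (a ∷ v) = barParity-map-ι v

negT-map-ι-tabulate : ∀ {r} n (f : Fin (suc n) → Fin r) →
                      negT (map ι (tabulate f)) ≡ init (map ι (tabulate f)) ∷ʳ bar (ι (f (fromℕ n)))
negT-map-ι-tabulate zero f = refl
negT-map-ι-tabulate (suc n) f = cong (ι (f zero) ∷_) (negT-map-ι-tabulate n (f ∘ suc))

lookup-snoc2-penultimate : ∀ {m} (xs : Vec (SE r) m) {a b} → lookup (snoc2 xs a b) (inject₁ (fromℕ m)) ≡ a
lookup-snoc2-penultimate [] = refl
lookup-snoc2-penultimate (x ∷ xs) = lookup-snoc2-penultimate xs

lookup-snoc2-last : ∀ {m} (xs : Vec (SE r) m) {a b} → lookup (snoc2 xs a b) (fromℕ (suc m)) ≡ b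
lookup-snoc2-last [] = refl
lookup-snoc2-last (x ∷ xs) = lookup-snoc2-last xs

lookup-snoc2-front : ∀ {m} (xs : Vec (SE r) m) {a b c d} {i} →
                     i ≢ inject₁ (fromℕ m) → i ≢ fromℕ (suc m) →
                     lookup (snoc2 xs a b) i ≡ lookup (snoc2 xs c d) i
lookup-snoc2-front [] {i = zero} i≢p _ = contradiction refl i≢p
lookup-snoc2-front [] {i = suc zero} _ i≢l = contradiction refl i≢l
lookup-snoc2-front (x ∷ xs) {i = zero} _ _ = refl
lookup-snoc2-front (x ∷ xs) {i = suc i} i≢p i≢l = lookup-snoc2-front xs (i≢p ∘ cong suc) (i≢l ∘ cong suc)

stars-snoc2 : ∀ {m} (xs : Vec (SE r) m) {p q x y x′ y′} →
              map star (snoc2 xs (p , x) (q , y)) ≡ map star (snoc2 xs (p , x′) (q , y′))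
stars-snoc2 [] = refl
stars-snoc2 (z ∷ xs) = cong (star z ∷_) (stars-snoc2 xs)

swapAt-snoc2 : ∀ {m} (xs : Vec (SE r) m) a b → swapAt (fromℕ m) (snoc2 xs a b) ≡ snoc2 xs (bar b) a
swapAt-snoc2 [] a b = refl
swapAt-snoc2 (x ∷ xs) a b = cong (x ∷_) (swapAt-snoc2 xs a b)

barParity-snoc2 : ∀ {m} (xs : Vec (SE r) m) a b →
                  barParity (snoc2 xs a b) ≡ proj₂ a xor (proj₂ b xor barParity xs)
barParity-snoc2 [] a b = refl
barParity-snoc2 (z ∷ xs) a b = begin
  proj₂ z xor barParity (snoc2 xs a b)                 ≡⟨ cong (proj₂ z xor_) (barParity-snoc2 xs a b) ⟩
  proj₂ z xor (proj₂ a xor (proj₂ b xor barParity xs)) ≡⟨ x∙yz≈y∙xz (proj₂ z) (proj₂ a) _ ⟩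
  proj₂ a xor (proj₂ z xor (proj₂ b xor barParity xs)) ≡⟨ cong (proj₂ a xor_) (x∙yz≈y∙xz (proj₂ z) (proj₂ b) _) ⟩
  proj₂ a xor (proj₂ b xor (proj₂ z xor barParity xs)) ∎

parity-snoc2 : ∀ {m} (xs : Vec (SE r) m) p q x y →
               parity (snoc2 xs (p , x) (q , y)) ≡ x xor (y xor parity (snoc2 xs (p , false) (q , false)))
parity-snoc2 xs p q x y = begin
  barParity (snoc2 xs (p , x) (q , y)) xor I
    ≡⟨ cong₂ _xor_ (barParity-snoc2 xs (p , x) (q , y)) (cong inversionParity (stars-snoc2 xs)) ⟩
  (x xor (y xor barParity xs)) xor I₀
    ≡⟨ xor-assoc x _ I₀ ⟩
  x xor ((y xor barParity xs) xor I₀)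
    ≡⟨ cong (x xor_) (xor-assoc y (barParity xs) I₀) ⟩
  x xor (y xor (barParity xs xor I₀))
    ≡⟨ cong (λ t → x xor (y xor (t xor I₀))) (barParity-snoc2 xs (p , false) (q , false)) ⟨
  x xor (y xor parity (snoc2 xs (p , false) (q , false)))
    ∎
  where
  I = inversionParity (map star (snoc2 xs (p , x) (q , y)))
  I₀ = inversionParity (map star (snoc2 xs (p , false) (q , false)))

snoc2-simplex-distinct : ∀ {m} (xs : Vec (SE r) m) {a b} → IsSimplex (snoc2 xs a b) → star a ≢ star b
snoc2-simplex-distinct {m = m} xs s e =
  s (inject₁ (fromℕ m)) (fromℕ (suc m)) (fromℕ≢inject₁ ∘ sym)
    (trans (cong star (lookup-snoc2-penultimate xs)) (trans e (cong star (sym (lookup-snoc2-last xs)))))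

-- star y occurs somewhere in [xs, a, b], and not among xs since [xs, y, z] is a simplex.
penultimate-star : ∀ {m} (xs : Vec (SE (suc (suc m))) m) {a b y z} →
                   IsSimplex (snoc2 xs a b) → IsSimplex (snoc2 xs y z) → star y ≡ star a ⊎ star y ≡ star b
penultimate-star {m} xs {a} {b} {y} {z} sab syz
  with simplex-covers (snoc2 xs a b) (snoc2 xs y z) sab (inject₁ (fromℕ m))
... | i , e with i ≟ inject₁ (fromℕ m) | i ≟ fromℕ (suc m)
...   | yes refl | _ = inj₁ (trans (cong star (sym (lookup-snoc2-penultimate xs)))
                                    (trans (sym e) (cong star (lookup-snoc2-penultimate xs))))
...   | no _ | yes refl = inj₂ (trans (cong star (sym (lookup-snoc2-penultimate xs)))
                                      (trans (sym e) (cong star (lookup-snoc2-last xs))))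
...   | no i≢p | no i≢l =
  contradiction (trans (cong star (lookup-snoc2-front xs i≢p i≢l)) e) (syz i (inject₁ (fromℕ m)) i≢p)

last-pair : ∀ {m} (xs : Vec (SE (suc (suc m))) m) {a b y z} →
            IsSimplex (snoc2 xs a b) → IsSimplex (snoc2 xs y z) →
            (star y ≡ star a × star z ≡ star b) ⊎ (star y ≡ star b × star z ≡ star a)
last-pair {m} xs {y = y} {z} sab syz
  with penultimate-star xs sab syz
     | penultimate-star xs sab (subst IsSimplex (swapAt-snoc2 xs y z) (swapAt-simplex (fromℕ m) _ syz))
... | inj₁ ya | inj₁ za = contradiction (trans ya (sym za)) (snoc2-simplex-distinct xs syz)
... | inj₁ ya | inj₂ zb = inj₁ (ya , zb)
... | inj₂ yb | inj₁ za = inj₂ (yb , za)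
... | inj₂ yb | inj₂ zb = contradiction (trans yb (sym zb)) (snoc2-simplex-distinct xs syz)

-- Moves

data Move {r k : ℕ} : Vec (SE r) (suc k) → Vec (SE r) (suc k) → Set where
  swap : ∀ i σ → Move σ (swapAt i σ)
  negate : ∀ σ → Move σ (negT σ)

infix 4 _⇝_
_⇝_ : ∀ {r k} → Vec (SE r) (suc k) → Vec (SE r) (suc k) → Set
_⇝_ = Star Move

move-simplex : ∀ {k} {σ τ : Vec (SE r) (suc k)} → Move σ τ → IsSimplex σ → IsSimplex τ
move-simplex (swap i σ) = swapAt-simplex i σ
move-simplex (negate σ) = negT-simplex σ

⇝-cons : ∀ {k} x {σ τ : Vec (SE r) (suc k)} → σ ⇝ τ → x ∷ σ ⇝ x ∷ τ
⇝-cons x = gmap (x ∷_) move-cons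
  where
  move-cons : ∀ {σ τ} → Move σ τ → Move (x ∷ σ) (x ∷ τ)
  move-cons (swap i σ) = swap (suc i) (x ∷ σ)
  move-cons (negate (y ∷ σ)) = negate (x ∷ y ∷ σ)

bar-involutive : (x : SE r) → bar (bar x) ≡ x
bar-involutive (e , b) = cong (e ,_) (not-involutive b)

-- [x, y, …] ⇝ [ȳ, x, …] ⇝ [x̄, ȳ, …], and ȳ is flipped back inside the tail.
barHead : ∀ {k} x (σ : Vec (SE r) k) → x ∷ σ ⇝ bar x ∷ σ
barHead x [] = return (negate (x ∷ []))
barHead x (y ∷ σ) =
  swap zero (x ∷ y ∷ σ) ◅ swap zero (bar y ∷ x ∷ σ) ◅
  subst (λ z → bar x ∷ bar y ∷ σ ⇝ bar x ∷ z ∷ σ) (bar-involutive y) (⇝-cons (bar x) (barHead (bar y) σ))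

retargetHead : ∀ {k x y} (σ : Vec (SE r) k) → star x ≡ star y → x ∷ σ ⇝ y ∷ σ
retargetHead {x = e , false} {_ , false} σ refl = ε
retargetHead {x = e , true} {_ , true} σ refl = ε
retargetHead {x = e , false} {_ , true} σ refl = barHead (e , false) σ
retargetHead {x = e , true} {_ , false} σ refl = barHead (e , true) σ

swapHeads : ∀ {k} x y (σ : Vec (SE r) k) → x ∷ y ∷ σ ⇝ y ∷ x ∷ σ
swapHeads x y σ = swap zero (x ∷ y ∷ σ) ◅ retargetHead (x ∷ σ) refl

toFront : ∀ {k} (i : Fin (suc k)) (σ : Vec (SE r) (suc k)) → σ ⇝ lookup σ i ∷ removeAt σ i
toFront zero (x ∷ σ) = ε
toFront (suc i) (x ∷ y ∷ σ) =
  ⇝-cons x (toFront i (y ∷ σ)) ◅◅ swapHeads x (lookup (y ∷ σ) i) (removeAt (y ∷ σ) i)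

reach : ∀ {k} (σ τ : Vec (SE r) (suc k)) → IsSimplex τ → Covers σ τ → σ ⇝ τ
reach {k = zero} (x ∷ []) (t ∷ []) _ cover with cover zero
... | zero , e = retargetHead [] e
reach {k = suc k} σ (t ∷ τ) sτ cover with cover zero
... | i , e = toFront i σ ◅◅ retargetHead _ e ◅◅ ⇝-cons t (reach (removeAt σ i) τ (simplex-tail sτ) cover′)
  where
  cover′ : Covers (removeAt σ i) τ
  cover′ j with cover (suc j)
  ... | l , e′ = punchOut i≢l , trans (cong star (removeAt-punchOut σ i≢l)) e′
    where
    i≢l : i ≢ l
    i≢l refl = sτ zero (suc j) (λ ()) (trans (sym e) e′)

⇝-base : ∀ {n} (σ : Vec (SE (suc n)) (suc n)) → IsSimplex σ → σ ⇝ base n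
⇝-base {n} σ s = reach σ (base n) (base-simplex n) (simplex-covers σ (base n) s)

-- The two chirotopes

paritySign : ∀ {k} → Bool → Vec (SE r) k → Sign
paritySign c σ with simplex? σ
... | yes _ = sg (parity σ xor c)
... | no _ = zer

paritySign-simplex : ∀ {k} c (σ : Vec (SE r) k) → IsSimplex σ → paritySign c σ ≡ sg (parity σ xor c)
paritySign-simplex c σ s with simplex? σ
... | yes _ = refl
... | no ¬s = contradiction s ¬s

paritySign-nonSimplex : ∀ {k} c (σ : Vec (SE r) k) → ¬ IsSimplex σ → paritySign c σ ≡ zer
paritySign-nonSimplex c σ ¬s with simplex? σ
... | yes s = contradiction s ¬s
... | no _ = refl

paritySign-nonzero⇒simplex : ∀ {k} c {σ : Vec (SE r) k} → paritySign c σ ≢ zer → IsSimplex σ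
paritySign-nonzero⇒simplex c {σ} σ≢0 with simplex? σ
... | yes s = s
... | no _ = contradiction refl σ≢0

paritySign-nonzero : ∀ {k} c {σ : Vec (SE r) k} → IsSimplex σ → paritySign c σ ≢ zer
paritySign-nonzero c {σ} s = sg≢zer _ ∘ trans (sym (paritySign-simplex c σ s))

paritySign-swapAt : ∀ {k} c (i : Fin k) (σ : Vec (SE r) (suc k)) → IsSimplex σ →
                    paritySign c (swapAt i σ) ≡ paritySign c σ
paritySign-swapAt c i σ s = begin
  paritySign c (swapAt i σ)         ≡⟨ paritySign-simplex c (swapAt i σ) (swapAt-simplex i σ s) ⟩
  sg (parity (swapAt i σ) xor c)    ≡⟨ cong (λ t → sg (t xor c)) (parity-swapAt i σ s) ⟩
  sg (parity σ xor c)               ≡⟨ paritySign-simplex c σ s ⟨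
  paritySign c σ                    ∎

paritySign-negT : ∀ {k} c (σ : Vec (SE r) (suc k)) → IsSimplex σ → paritySign c (negT σ) ≡ -ˢ paritySign c σ
paritySign-negT c σ s = begin
  paritySign c (negT σ)             ≡⟨ paritySign-simplex c (negT σ) (negT-simplex σ s) ⟩
  sg (parity (negT σ) xor c)        ≡⟨ cong (λ t → sg (t xor c)) (parity-negT σ) ⟩
  sg (not (parity σ) xor c)         ≡⟨ cong sg (not-distribˡ-xor (parity σ) c) ⟨
  sg (not (parity σ xor c))         ≡⟨ sg-not (parity σ xor c) ⟩
  -ˢ sg (parity σ xor c)            ≡⟨ cong -ˢ_ (paritySign-simplex c σ s) ⟨
  -ˢ paritySign c σ                 ∎

paritySign-~ : ∀ {k} c (σ τ : Vec (SE r) (suc k)) → IsSimplex σ → IsSimplex τ → σ ~ τ →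
               paritySign c σ ≡ paritySign c τ
paritySign-~ c σ τ sσ sτ σ~τ = trans (paritySign-simplex c σ sσ)
  (trans (cong (λ t → sg (t xor c)) (parity-~ sσ σ~τ)) (sym (paritySign-simplex c τ sτ)))

stars-init-∷ʳ : ∀ {r k} (σ : Vec (SE r) (suc k)) {z} → star z ≡ star (last σ) →
                map star (init σ ∷ʳ z) ≡ map star σ
stars-init-∷ʳ (x ∷ []) e = cong (_∷ []) e
stars-init-∷ʳ (x ∷ y ∷ σ) e = cong (star x ∷_) (stars-init-∷ʳ (y ∷ σ) e)

paritySign-C1 : ∀ {n} c (e : Fin (suc n)) → ∃[ es ] paritySign c (map ι (e ∷ es)) ≢ zer
paritySign-C1 c e = tabulate (punchIn e) , paritySign-nonzero c (map-ι-simplex (e ∷ tabulate (punchIn e)) distinct)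
  where
  distinct : Injective _≡_ _≡_ (lookup (e ∷ tabulate (punchIn e)))
  distinct {zero} {zero} _ = refl
  distinct {zero} {suc j} e≡ = contradiction (sym (trans e≡ (lookup∘tabulate (punchIn e) j))) (punchInᵢ≢i e j)
  distinct {suc i} {zero} ≡e = contradiction (trans (sym (lookup∘tabulate (punchIn e) i)) ≡e) (punchInᵢ≢i e i)
  distinct {suc i} {suc j} eq = cong suc (punchIn-injective e i j
    (trans (sym (lookup∘tabulate (punchIn e) i)) (trans eq (lookup∘tabulate (punchIn e) j))))

paritySign-C3 : ∀ {n} c (x y : Vec (SE (suc n)) (suc n)) → paritySign c x ≢ zer → paritySign c y ≢ zer →
                ∃[ i ] paritySign c (init x ∷ʳ lookup y i) ≢ zer
paritySign-C3 c x y x≢0 y≢0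
  with injective⇒covering (simplex-injective y (paritySign-nonzero⇒simplex c y≢0)) (star (last x))
... | i , e = i , paritySign-nonzero c
  (simplex-resp-stars x (init x ∷ʳ lookup y i) (sym (stars-init-∷ʳ x e)) (paritySign-nonzero⇒simplex c x≢0))

module LastPairSigns (c : Bool) {m : ℕ} (xs : Vec (SE (suc (suc m))) m) (p q : Fin (suc (suc m)))
                     (s : IsSimplex (snoc2 xs (p , false) (q , false))) where

  simplex-at : ∀ x y → IsSimplex (snoc2 xs (p , x) (q , y))
  simplex-at x y = simplex-resp-stars (snoc2 xs (p , false) (q , false)) (snoc2 xs (p , x) (q , y)) (stars-snoc2 xs) s

  κ : Bool
  κ = parity (snoc2 xs (p , false) (q , false)) xor c

  paritySign-at : ∀ x y → paritySign c (snoc2 xs (p , x) (q , y)) ≡ sg (x xor (y xor κ))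
  paritySign-at x y = begin
    paritySign c (snoc2 xs (p , x) (q , y))         ≡⟨ paritySign-simplex c (snoc2 xs (p , x) (q , y)) (simplex-at x y) ⟩
    sg (parity (snoc2 xs (p , x) (q , y)) xor c)    ≡⟨ cong (λ t → sg (t xor c)) (parity-snoc2 xs p q x y) ⟩
    sg ((x xor (y xor P₀)) xor c)                   ≡⟨ cong sg (xor-assoc x (y xor P₀) c) ⟩
    sg (x xor ((y xor P₀) xor c))                   ≡⟨ cong (λ t → sg (x xor t)) (xor-assoc y P₀ c) ⟩
    sg (x xor (y xor κ))                            ∎
    where
    P₀ = parity (snoc2 xs (p , false) (q , false))

  exchange-NonNeg : ∀ a b a′ b′ →
    NonNeg (paritySign c (snoc2 xs (p , a) (q , b)) *ˢ paritySign c (snoc2 xs (p , a′) (q , b′))) →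
    NonNeg (paritySign c (snoc2 xs (p , a′) (q , b)) *ˢ paritySign c (snoc2 xs (p , a) (q , b′)))
  exchange-NonNeg a b a′ b′ h =
    subst NonNeg (sym (cong₂ _*ˢ_ (paritySign-at a′ b) (paritySign-at a b′)))
      (≡⇒NonNeg-sg-*ˢ (xor-exchange a a′
        (NonNeg-sg-*ˢ⇒≡ (subst NonNeg (cong₂ _*ˢ_ (paritySign-at a b) (paritySign-at a′ b′)) h))))

  paritySign-swapped : ∀ x y → paritySign c (snoc2 xs (q , x) (p , y)) ≡ paritySign c (snoc2 xs (p , y) (q , not x))
  paritySign-swapped x y = begin
    paritySign c (snoc2 xs (q , x) (p , y))
      ≡⟨ cong (λ t → paritySign c (snoc2 xs (q , t) (p , y))) (not-involutive x) ⟨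
    paritySign c (snoc2 xs (bar (q , not x)) (p , y))
      ≡⟨ cong (paritySign c) (swapAt-snoc2 xs (p , y) (q , not x)) ⟨
    paritySign c (swapAt (fromℕ m) (snoc2 xs (p , y) (q , not x)))
      ≡⟨ paritySign-swapAt c (fromℕ m) _ (simplex-at y (not x)) ⟩
    paritySign c (snoc2 xs (p , y) (q , not x))
      ∎

paritySign-NonNeg-on-simplices : ∀ {r k} c (σ τ : Vec (SE r) k) →
  (IsSimplex σ → IsSimplex τ → NonNeg (paritySign c σ *ˢ paritySign c τ)) →
  NonNeg (paritySign c σ *ˢ paritySign c τ)
paritySign-NonNeg-on-simplices c σ τ k = by-cases (simplex? σ) (simplex? τ)
  where
  by-cases : Dec (IsSimplex σ) → Dec (IsSimplex τ) → NonNeg (paritySign c σ *ˢ paritySign c τ)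
  by-cases (no ¬sσ) _ = NonNeg-*ˢ-zero {paritySign c σ} (inj₁ (paritySign-nonSimplex c σ ¬sσ))
  by-cases (yes _) (no ¬sτ) = NonNeg-*ˢ-zero {paritySign c σ} (inj₂ (paritySign-nonSimplex c τ ¬sτ))
  by-cases (yes sσ) (yes sτ) = k sσ sτ

paritySign-C4 : ∀ c n → C4 n (paritySign {suc n} c)
paritySign-C4 c zero = tt
paritySign-C4 c (suc m) xs (p , α) (q , β) (p₁ , s₁) (q₁ , s₂) h₁ h₂ =
  paritySign-NonNeg-on-simplices c (snoc2 xs (p , α) (q , β)) (snoc2 xs (p₁ , s₁) (q₁ , s₂)) by-last-pair
  where
  by-last-pair : IsSimplex (snoc2 xs (p , α) (q , β)) → IsSimplex (snoc2 xs (p₁ , s₁) (q₁ , s₂)) →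
                 NonNeg (paritySign c (snoc2 xs (p , α) (q , β)) *ˢ paritySign c (snoc2 xs (p₁ , s₁) (q₁ , s₂)))
  by-last-pair sab syy with last-pair xs sab syy
  ... | inj₁ (refl , refl) = exchange-NonNeg s₁ β α s₂ h₁
    where open LastPairSigns c xs p q (simplex-resp-stars _ _ (stars-snoc2 xs) sab)
  ... | inj₂ (refl , refl) =
    subst (λ t → NonNeg (paritySign c (snoc2 xs (p , α) (q , β)) *ˢ t))
          (sym (paritySign-swapped s₁ s₂))
          (exchange-NonNeg s₂ β α (not s₁) h₂)
    where open LastPairSigns c xs p q (simplex-resp-stars _ _ (stars-snoc2 xs) sab)

parityChirotope : Bool → (n : ℕ) → Chirotope n
parityChirotope c n = record
  { χ = paritySign c
  ; nonSimplex = paritySign-nonSimplex c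
  ; C1 = paritySign-C1 c
  ; C2-neg = paritySign-negT c
  ; C2-sim = paritySign-~ c
  ; C3 = paritySign-C3 c
  ; C4-ax = paritySign-C4 c n
  }

paritySign-base : ∀ c n → paritySign c (base n) ≡ sg c
paritySign-base c n =
  trans (paritySign-simplex c (base n) (base-simplex n)) (cong (λ t → sg (t xor c)) (parity-base n))

paritySign-negT-base : ∀ c n → paritySign c (init (base n) ∷ʳ bar (ι (fromℕ n))) ≡ -ˢ sg c
paritySign-negT-base c n = begin
  paritySign c (init (base n) ∷ʳ bar (ι (fromℕ n)))  ≡⟨ cong (paritySign c) (negT-map-ι-tabulate n id) ⟨
  paritySign c (negT (base n))                        ≡⟨ paritySign-negT c (base n) (base-simplex n) ⟩
  -ˢ paritySign c (base n)                            ≡⟨ cong -ˢ_ (paritySign-base c n) ⟩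
  -ˢ sg c                                             ∎

-- Uniqueness

module _ {n : ℕ} (X : Chirotope n) where
  open Chirotope X

  χ-swapAt : ∀ i σ → IsSimplex σ → χ (swapAt i σ) ≡ χ σ
  χ-swapAt i σ s = sym (C2-sim σ (swapAt i σ) s (swapAt-simplex i σ s) (return (fwd (step i σ))))

  normalised : Vec (SE (suc n)) (suc n) → Sign
  normalised σ = sg (parity σ) *ˢ χ σ

  normalised-move : ∀ {σ τ} → Move σ τ → IsSimplex σ → normalised σ ≡ normalised τ
  normalised-move (swap i σ) s = sym (cong₂ _*ˢ_ (cong sg (parity-swapAt i σ s)) (χ-swapAt i σ s))
  normalised-move (negate σ) s = sym (begin
    sg (parity (negT σ)) *ˢ χ (negT σ)     ≡⟨ cong₂ _*ˢ_ (cong sg (parity-negT σ)) (C2-neg σ s) ⟩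
    sg (not (parity σ)) *ˢ (-ˢ χ σ)        ≡⟨ sg-not-*ˢ-negated (parity σ) (χ σ) ⟩
    sg (parity σ) *ˢ χ σ                   ∎)

  normalised-⇝ : ∀ {σ τ} → σ ⇝ τ → IsSimplex σ → normalised σ ≡ normalised τ
  normalised-⇝ ε s = refl
  normalised-⇝ (move ◅ moves) s = trans (normalised-move move s) (normalised-⇝ moves (move-simplex move s))

  χ-from-base : ∀ σ → IsSimplex σ → χ σ ≡ sg (parity σ) *ˢ χ (base n)
  χ-from-base σ s = begin
    χ σ                                          ≡⟨ sg-*ˢ-involutive (parity σ) (χ σ) ⟨
    sg (parity σ) *ˢ normalised σ                ≡⟨ cong (sg (parity σ) *ˢ_) (normalised-⇝ (⇝-base σ s) s) ⟩
    sg (parity σ) *ˢ normalised (base n)         ≡⟨ cong (λ t → sg (parity σ) *ˢ (sg t *ˢ χ (base n))) (parity-base n) ⟩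
    sg (parity σ) *ˢ (pos *ˢ χ (base n))         ≡⟨ cong (sg (parity σ) *ˢ_) (*ˢ-identityˡ (χ (base n))) ⟩
    sg (parity σ) *ˢ χ (base n)                  ∎

  χ-base-nonzero : χ (base n) ≢ zer
  χ-base-nonzero base≡0 with C1 zero
  ... | es , σ≢0 with simplex? (map ι (zero ∷ es))
  ...   | no ¬s = σ≢0 (nonSimplex _ ¬s)
  ...   | yes s = σ≢0 (trans (χ-from-base _ s) (trans (cong (sg p *ˢ_) base≡0) (*ˢ-zeroʳ (sg p))))
    where p = parity (map ι (zero ∷ es))

  χ≡paritySign : ∀ {c} → χ (base n) ≡ sg c → ∀ σ → χ σ ≡ paritySign c σ
  χ≡paritySign {c} base≡c σ = by-cases (simplex? σ)
    where
    by-cases : Dec (IsSimplex σ) → χ σ ≡ paritySign c σ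
    by-cases (no ¬s) = trans (nonSimplex σ ¬s) (sym (paritySign-nonSimplex c σ ¬s))
    by-cases (yes s) = begin
      χ σ                          ≡⟨ χ-from-base σ s ⟩
      sg (parity σ) *ˢ χ (base n)  ≡⟨ cong (sg (parity σ) *ˢ_) base≡c ⟩
      sg (parity σ) *ˢ sg c        ≡⟨ sg-xor (parity σ) c ⟨
      sg (parity σ xor c)          ≡⟨ paritySign-simplex c σ s ⟨
      paritySign c σ               ∎

  classification : (∀ σ → χ σ ≡ paritySign false σ) ⊎ (∀ σ → χ σ ≡ paritySign true σ)
  classification with nonzero⇒sg χ-base-nonzero
  ... | false , base≡pos = inj₁ (χ≡paritySign base≡pos)
  ... | true , base≡neg = inj₂ (χ≡paritySign base≡neg)

lemma6p4 : (n : ℕ) →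
    Σ (Chirotope n) λ χ₁ → Σ (Chirotope n) λ χ₂ →
      (Chirotope.χ χ₁ (map ι (allFin (suc n))) ≡ pos)
      × (Chirotope.χ χ₂ (init (map ι (allFin (suc n))) ∷ʳ bar (ι (fromℕ n))) ≡ pos)
      × (∃[ σ ] Chirotope.χ χ₁ σ ≢ Chirotope.χ χ₂ σ)
      × ((c : Chirotope n) →
          ((σ : Vec (SE (suc n)) (suc n)) → Chirotope.χ c σ ≡ Chirotope.χ χ₁ σ)
          ⊎ ((σ : Vec (SE (suc n)) (suc n)) → Chirotope.χ c σ ≡ Chirotope.χ χ₂ σ))
lemma6p4 n =
  parityChirotope false n , parityChirotope true n ,
  paritySign-base false n ,
  paritySign-negT-base true n ,
  (base n , λ e → case trans (sym (paritySign-base false n)) (trans e (paritySign-base true n)) of λ ()) ,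
  classification
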